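{- Let $S=\langle \underline{S},\sqcap,\sqcup,\Rightarrow,L,\neg,0,1\rangle$ be a rough algebra, let $M(x)=\neg L(\neg x)$, and let $T\subseteq \underline{S}^2$ be defined by $(a,b)\in T$ if and only if there exists $c\in\underline{S}$ with $L(c)\le a\le M(c)$ and $L(c)\le b\le M(c)$ (here $\le$ is the lattice order of $\langle\underline{S},\sqcap,\sqcup\rangle$). Then $T$ is a compatible tolerance on $S$: $T$ is reflexive and symmetric, and whenever $(a,b),(c,e)\in T$ one has $(a\sqcap c,\,b\sqcap e)\in T$ and $(a\sqcup c,\,b\sqcup e)\in T$.
   Context: A pre-rough algebra is an algebra $S=\langle\underline{S},\sqcap,\sqcup,\Rightarrow,L,\neg,0,1\rangle$ of type $(2,2,2,1,1,0,0)$ such that: $\langle\underline{S},\sqcap,\sqcup,\neg\rangle$ is a de Morgan lattice (with bounds $0,1$); $\neg\neg a=a$; $L(a)\sqcap a=L(a)$; $LL(a)=L(a)$; $L(1)=1$; $L(a\sqcap b)=L(a)\sqcap L(b)$; $\neg L\neg L(a)=L(a)$; $\neg L(a)\sqcup L(a)=1$; $L(a\sqcup b)=L(a)\sqcup L(b)$; if $L(a)\sqcap L(b)=L(a)$ and $\neg L(\neg(a\sqcap b))=\neg L(\neg a)$ then $a\sqcap b=a$; and $a\Rightarrow b=(\neg L(a)\sqcup L(b))\sqcap(L(\neg a)\sqcup\neg L(\neg b))$. A rough algebra is a pre-rough algebra whose lattice reduct is completely distributive. The relation $T$ is called the coapproximability relation. -}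

module Defs where

open import Level using (0ℓ)
open import Data.Product using (Σ; _×_; _,_)
open import Relation.Binary.PropositionalEquality using (_≡_)
open import Algebra.Core using (Op₁; Op₂)
open import Algebra.Lattice.Structures using (IsDistributiveLattice)

record PreRoughAlgebra : Set₁ where
  infixr 7 _⊓_
  infixr 6 _⊔_
  infixr 5 _⇒_
  field
    Carrier : Set
    _⊓_ _⊔_ _⇒_ : Op₂ Carrier
    L ¬ : Op₁ Carrier
    𝟘 𝟙 : Carrier
    isDistributiveLattice : IsDistributiveLattice _≡_ _⊔_ _⊓_
    𝟘-bottom : ∀ a → 𝟘 ⊓ a ≡ 𝟘
    𝟙-top : ∀ a → 𝟙 ⊔ a ≡ 𝟙
    ¬-deMorgan : ∀ a b → ¬ (a ⊓ b) ≡ ¬ a ⊔ ¬ b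
    ¬¬ : ∀ a → ¬ (¬ a) ≡ a
    L-deflationary : ∀ a → L a ⊓ a ≡ L a
    L-idem : ∀ a → L (L a) ≡ L a
    L-𝟙 : L 𝟙 ≡ 𝟙
    L-⊓ : ∀ a b → L (a ⊓ b) ≡ L a ⊓ L b
    ¬L¬L : ∀ a → ¬ (L (¬ (L a))) ≡ L a
    ¬L⊔L : ∀ a → ¬ (L a) ⊔ L a ≡ 𝟙
    L-⊔ : ∀ a b → L (a ⊔ b) ≡ L a ⊔ L b
    L-M-determine : ∀ a b → L a ⊓ L b ≡ L a →
      ¬ (L (¬ (a ⊓ b))) ≡ ¬ (L (¬ a)) → a ⊓ b ≡ a
    ⇒-def : ∀ a b →
      (a ⇒ b) ≡ (¬ (L a) ⊔ L b) ⊓ (L (¬ a) ⊔ ¬ (L (¬ b)))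

  _≤_ : Carrier → Carrier → Set
  a ≤ b = a ⊓ b ≡ a

  M : Op₁ Carrier
  M x = ¬ (L (¬ x))

  IsSup : {I : Set} → (I → Carrier) → Carrier → Set
  IsSup {I} x s = (∀ i → x i ≤ s) × (∀ u → (∀ i → x i ≤ u) → s ≤ u)

  IsInf : {I : Set} → (I → Carrier) → Carrier → Set
  IsInf {I} x m = (∀ i → m ≤ x i) × (∀ u → (∀ i → u ≤ x i) → u ≤ m)

  Complete : Set₁
  Complete = (I : Set) (x : I → Carrier) →
    Σ Carrier (IsSup x) × Σ Carrier (IsInf x)

  -- complete distributivity:
  --   ⋀_{i ∈ I} ⋁_{j ∈ J i} a i j = ⋁_{f ∈ Π_i J i} ⋀_{i ∈ I} a i (f i)
  CompletelyDistributiveLaw : Set₁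
  CompletelyDistributiveLaw =
    (I : Set) (J : I → Set) (a : (i : I) → J i → Carrier)
    (s : I → Carrier) (m : Carrier) (t : ((i : I) → J i) → Carrier) (u : Carrier) →
    (∀ i → IsSup (a i) (s i)) → IsInf s m →
    (∀ f → IsInf (λ i → a i (f i)) (t f)) → IsSup t u →
    m ≡ u

record RoughAlgebra : Set₂ where
  field
    preRough : PreRoughAlgebra
  open PreRoughAlgebra preRough public
  field
    complete : Complete
    completelyDistributive : CompletelyDistributiveLaw

module _ (S : RoughAlgebra) where
  open RoughAlgebra S

  T : Carrier → Carrier → Set
  T a b = Σ Carrier λ c → (L c ≤ a × a ≤ M c) × (L c ≤ b × b ≤ M c)

{-# OPTIONS --safe #-}
module Submission where

open import Level using (0ℓ)
open import Data.Product using (_×_; _,_)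
open import Relation.Binary.PropositionalEquality
open import Algebra.Lattice.Bundles using (Lattice)
open import Algebra.Lattice.Structures using (IsDistributiveLattice)
import Algebra.Lattice.Properties.Lattice as LatticeProperties
open import Relation.Binary.Lattice.Bundles using () renaming (Lattice to OrderLattice)
import Relation.Binary.Lattice.Properties.JoinSemilattice as JoinSemilatticeProperties
import Relation.Binary.Lattice.Properties.MeetSemilattice as MeetSemilatticeProperties
open import Defs

-- The rough interval [L c, M c] is closed under pointwise meets and joins
-- because L and M both preserve ⊓ and ⊔; T relates two elements lying in
-- a common rough interval, so T is a compatible tolerance.

module PreRoughAlgebraProperties (S : PreRoughAlgebra) where
  open PreRoughAlgebra S
  open IsDistributiveLattice isDistributiveLattice using (isLattice; ∨-comm)
  open ≡-Reasoning

  -- The library orders a lattice by x ≈ x ∧ y, the symmetric form of _≤_.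
  private
    lattice : Lattice 0ℓ 0ℓ
    lattice = record { isLattice = isLattice }

    order : OrderLattice 0ℓ 0ℓ 0ℓ
    order = LatticeProperties.∨-∧-orderTheoreticLattice lattice
    open JoinSemilatticeProperties (OrderLattice.joinSemilattice order)
      using (∨-monotonic; x≤y⇒x∨y≈y)
    open MeetSemilatticeProperties (OrderLattice.meetSemilattice order)
      using (∧-monotonic)

  ⊓-mono-≤ : ∀ {a b c d} → a ≤ b → c ≤ d → (a ⊓ c) ≤ (b ⊓ d)
  ⊓-mono-≤ a≤b c≤d = sym (∧-monotonic (sym a≤b) (sym c≤d))

  ⊔-mono-≤ : ∀ {a b c d} → a ≤ b → c ≤ d → (a ⊔ c) ≤ (b ⊔ d)
  ⊔-mono-≤ a≤b c≤d = sym (∨-monotonic (sym a≤b) (sym c≤d))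

  ¬-⊔ : ∀ a b → ¬ (a ⊔ b) ≡ ¬ a ⊓ ¬ b
  ¬-⊔ a b = begin
    ¬ (a ⊔ b)             ≡⟨ cong₂ (λ x y → ¬ (x ⊔ y)) (sym (¬¬ a)) (sym (¬¬ b)) ⟩
    ¬ (¬ (¬ a) ⊔ ¬ (¬ b)) ≡⟨ cong ¬ (sym (¬-deMorgan (¬ a) (¬ b))) ⟩
    ¬ (¬ (¬ a ⊓ ¬ b))     ≡⟨ ¬¬ (¬ a ⊓ ¬ b) ⟩
    ¬ a ⊓ ¬ b             ∎

  ¬-antitone : ∀ {a b} → a ≤ b → ¬ b ≤ ¬ a
  ¬-antitone {a} {b} a≤b = begin
    ¬ b ⊓ ¬ a ≡⟨ sym (¬-⊔ b a) ⟩
    ¬ (b ⊔ a) ≡⟨ cong ¬ (trans (∨-comm b a) (x≤y⇒x∨y≈y (sym a≤b))) ⟩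
    ¬ b       ∎

  M-inflationary : ∀ a → a ≤ M a
  M-inflationary a = subst (_≤ M a) (¬¬ a) (¬-antitone (L-deflationary (¬ a)))

  M-⊓ : ∀ a b → M (a ⊓ b) ≡ M a ⊓ M b
  M-⊓ a b = begin
    ¬ (L (¬ (a ⊓ b)))      ≡⟨ cong (λ x → ¬ (L x)) (¬-deMorgan a b) ⟩
    ¬ (L (¬ a ⊔ ¬ b))      ≡⟨ cong ¬ (L-⊔ (¬ a) (¬ b)) ⟩
    ¬ (L (¬ a) ⊔ L (¬ b))  ≡⟨ ¬-⊔ (L (¬ a)) (L (¬ b)) ⟩
    M a ⊓ M b              ∎

  M-⊔ : ∀ a b → M (a ⊔ b) ≡ M a ⊔ M b
  M-⊔ a b = begin
    ¬ (L (¬ (a ⊔ b)))      ≡⟨ cong (λ x → ¬ (L x)) (¬-⊔ a b) ⟩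
    ¬ (L (¬ a ⊓ ¬ b))      ≡⟨ cong ¬ (L-⊓ (¬ a) (¬ b)) ⟩
    ¬ (L (¬ a) ⊓ L (¬ b))  ≡⟨ ¬-deMorgan (L (¬ a)) (L (¬ b)) ⟩
    M a ⊔ M b              ∎

  InRoughInterval : Carrier → Carrier → Set
  InRoughInterval c a = L c ≤ a × a ≤ M c

  inRoughInterval-self : ∀ a → InRoughInterval a a
  inRoughInterval-self a = L-deflationary a , M-inflationary a

  inRoughInterval-⊓ : ∀ {c d a b} → InRoughInterval c a → InRoughInterval d b →
    InRoughInterval (c ⊓ d) (a ⊓ b)
  inRoughInterval-⊓ {c} {d} {a} {b} (Lc≤a , a≤Mc) (Ld≤b , b≤Md) =
    subst (_≤ (a ⊓ b)) (sym (L-⊓ c d)) (⊓-mono-≤ Lc≤a Ld≤b) ,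
    subst ((a ⊓ b) ≤_) (sym (M-⊓ c d)) (⊓-mono-≤ a≤Mc b≤Md)

  inRoughInterval-⊔ : ∀ {c d a b} → InRoughInterval c a → InRoughInterval d b →
    InRoughInterval (c ⊔ d) (a ⊔ b)
  inRoughInterval-⊔ {c} {d} {a} {b} (Lc≤a , a≤Mc) (Ld≤b , b≤Md) =
    subst (_≤ (a ⊔ b)) (sym (L-⊔ c d)) (⊔-mono-≤ Lc≤a Ld≤b) ,
    subst ((a ⊔ b) ≤_) (sym (M-⊔ c d)) (⊔-mono-≤ a≤Mc b≤Md)

module Coapproximability (S : RoughAlgebra) where
  open RoughAlgebra S
  open PreRoughAlgebraProperties preRough

  T-refl : ∀ a → T S a a
  T-refl a = a , inRoughInterval-self a , inRoughInterval-self a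

  T-sym : ∀ a b → T S a b → T S b a
  T-sym a b (c , a∈c , b∈c) = c , b∈c , a∈c

  T-⊓ : ∀ a b c e → T S a b → T S c e → T S (a ⊓ c) (b ⊓ e)
  T-⊓ a b c e (d₁ , a∈d₁ , b∈d₁) (d₂ , c∈d₂ , e∈d₂) =
    d₁ ⊓ d₂ , inRoughInterval-⊓ a∈d₁ c∈d₂ , inRoughInterval-⊓ b∈d₁ e∈d₂

  T-⊔ : ∀ a b c e → T S a b → T S c e → T S (a ⊔ c) (b ⊔ e)
  T-⊔ a b c e (d₁ , a∈d₁ , b∈d₁) (d₂ , c∈d₂ , e∈d₂) =
    d₁ ⊔ d₂ , inRoughInterval-⊔ a∈d₁ c∈d₂ , inRoughInterval-⊔ b∈d₁ e∈d₂

proposition2p1 : (S : RoughAlgebra) → let open RoughAlgebra S in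
    (∀ a → T S a a)
    × (∀ a b → T S a b → T S b a)
    × (∀ a b c e → T S a b → T S c e → T S (a ⊓ c) (b ⊓ e))
    × (∀ a b c e → T S a b → T S c e → T S (a ⊔ c) (b ⊔ e))
proposition2p1 S = T-refl , T-sym , T-⊓ , T-⊔
  where open Coapproximability S
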